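{- Let $1\le t\le n$ and let $q$ be a product of $k\ge1$ pairwise distinct primes. Then $\mathrm{DI}(\mathbf{THR}_n^t,q)\ge 2^{n-t+1}/k$. In particular, for prime $q$, $\mathrm{DI}(\mathbf{THR}_n^t,q)\ge 2^{n-t+1}$.
   Context: For a predicate $P:\mathcal X\times\mathcal Y\to\{0,1\}$ (finite sets) and integer $q\ge2$, an inner product encoding of $P$ modulo $q$ of length $\ell$ is a pair of maps $x\mapsto \vec x\in\mathbb Z_q^\ell$, $y\mapsto\vec y\in\mathbb Z_q^\ell$ such that for all $x,y$: $P(x,y)=1$ iff $\sum_{i=1}^\ell\vec x_i\vec y_i\equiv0\pmod q$; $\mathrm{DI}(P,q)$ is the minimum such $\ell$. For $t\in[n]$, the threshold predicate $\mathbf{THR}_n^t:2^{[n]}\times2^{[n]}\to\{0,1\}$ is $\mathbf{THR}_n^t(S,T)=1$ iff $|S\cap T|\ge t$. -}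

module Defs where

open import Data.Nat using (ℕ; _≤ᵇ_; _*_; _+_)
open import Data.Nat.Divisibility using (_∣_)
open import Data.Nat.Primality using (Prime)
open import Data.Bool using (Bool; true)
open import Data.Fin using (Fin; toℕ)
open import Data.Fin.Subset using (Subset; _∩_; ∣_∣)
open import Data.Vec using (Vec; zipWith; foldr)
open import Data.List using (List; length)
open import Data.Nat.ListAction using (product)
open import Data.List.Relation.Unary.All using (All)
open import Data.List.Relation.Unary.Unique.Propositional using (Unique)
open import Data.Product using (Σ; _×_)
open import Relation.Binary.PropositionalEquality using (_≡_)
open import Function.Bundles using (_⇔_)

-- inner product of two vectors in Z_q^ℓ, computed in ℕ (to be reduced mod q)
innerProd : ∀ {q ℓ} → Vec (Fin q) ℓ → Vec (Fin q) ℓ → ℕ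
innerProd u v = foldr _ _+_ 0 (zipWith (λ a b → toℕ a * toℕ b) u v)

IsIPEncoding : {X Y : Set} → (X → Y → Bool) → (q ℓ : ℕ)
             → (X → Vec (Fin q) ℓ) → (Y → Vec (Fin q) ℓ) → Set
IsIPEncoding P q ℓ f g =
  ∀ x y → (P x y ≡ true) ⇔ (q ∣ innerProd (f x) (g y))

THR : (n t : ℕ) → Subset n → Subset n → Bool
THR n t S T = t ≤ᵇ ∣ S ∩ T ∣

ProductOfDistinctPrimes : (q k : ℕ) → Set
ProductOfDistinctPrimes q k =
  Σ (List ℕ) λ ps → length ps ≡ k × All Prime ps × Unique ps × product ps ≡ q

module Submission where

-- Let m = n − t + 1 and pad every A ⊆ [m] with the remaining t − 1 coordinates. Then
-- |pad A ∩ pad (∁ B)| = |A ∖ B| + t − 1, so THR holds on (pad A, pad (∁ B)) iff A ⊄ B.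
-- Listing the 2^m subsets so that none is contained in a later one, the entries
-- ⟨f (pad A), g (pad (∁ B))⟩ are divisible by q above the diagonal and not on it.
-- Modulo a prime p, a family of pairs in ℤ^ℓ that is triangular in this sense has at
-- most ℓ members: eliminating with the first pair as pivot gives a triangular family,
-- one shorter, in ℤ^(ℓ−1). For q = p₁⋯p_k each diagonal entry is nonzero modulo some pᵢ,
-- and the subsets assigned to pᵢ form a triangular family modulo pᵢ, so 2^m ≤ kℓ.

open import Defs
open import Data.Bool using (true)
open import Data.Bool.Properties using (T-≡)
open import Data.Empty using (⊥-elim)
open import Data.Fin using (Fin; zero; suc; toℕ)
open import Data.Fin.Properties using (¬∀⟶∃¬)
open import Data.Fin.Subset using (Subset; _∩_; ∣_∣; ∁; ⊤; inside; outside)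
open import Data.Fin.Subset.Properties using (∩-idem; ∩-inverseʳ; ∣⊤∣≡n; ∣⊥∣≡0)
open import Data.List using (List; []; _∷_; [_]; _++_; length; map; filter)
open import Data.List.Properties using (length-++; length-map)
open import Data.List.Relation.Unary.All as All using (All; []; _∷_)
open import Data.List.Relation.Unary.All.Properties using (¬All⇒Any¬; All¬⇒¬Any; all-filter)
import Data.List.Relation.Unary.All.Properties as All
open import Data.List.Relation.Unary.AllPairs as AllPairs using (AllPairs; []; _∷_)
import Data.List.Relation.Unary.AllPairs.Properties as AllPairs
open import Data.List.Relation.Unary.Any using (Any; here; there)
open import Data.List.Relation.Unary.Unique.Propositional using (Unique)
open import Data.Nat using (ℕ; zero; suc; _≤_; _<_; z≤n; s≤s)
open import Data.Nat.Primality using (Prime; euclidsLemma)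
open import Data.Product using (∃; _×_; _,_)
open import Data.Sum using (inj₁; inj₂)
open import Data.Vec using (Vec; []; _∷_; lookup) renaming (_++_ to _++ᵛ_)
open import Data.Vec.Functional using (Vector; removeAt; tail)
open import Function using (_∘_; _⇔_; mk⇔; Equivalence)
open import Relation.Nullary using (¬_; ¬?; yes; no)
open import Relation.Unary using (Decidable)
open import Relation.Binary.PropositionalEquality
  using (_≡_; refl; sym; trans; cong; cong₂; subst; module ≡-Reasoning)

allPairs-zip-allʳ : ∀ {A : Set} {P : A → Set} {R : A → A → Set} {xs} →
                    All P xs → AllPairs R xs → AllPairs (λ x y → R x y × P y) xs
allPairs-zip-allʳ []        []         = []
allPairs-zip-allʳ (_ ∷ pxs) (rx ∷ rxs) = All.zip (rx , pxs) ∷ allPairs-zip-allʳ pxs rxs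

module InnerProduct where
  import Data.Nat as ℕ
  import Data.Nat.Divisibility as ℕ
  open import Data.Integer using (ℤ; +_; 0ℤ; _+_; _*_; _-_; -_) renaming (∣_∣ to ∣_∣ℤ)
  open import Data.Integer.Divisibility.Signed
    using (_∣_; _∣?_; divides; ∣ᵤ⇒∣; ∣⇒∣ᵤ; ∣m∣n⇒∣m+n; ∣m∣n⇒∣m-n; ∣m+n∣n⇒∣m; ∣m⇒∣-m; ∣n⇒∣m*n)
  open import Data.Integer.Properties
    using (+-*-semiring; *-comm; neg-distribˡ-*; abs-*; pos-*; pos-+; +-identityˡ; *-zeroʳ)
  open import Data.Integer.Tactic.RingSolver using (solve-∀)
  open import Algebra.Properties.Semiring.Sum +-*-semiring
    using (sum-cong-≗; sum-remove; ∑-distrib-+; *-distribˡ-sum) renaming (sum to ∑)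

  ⟨_,_⟩ : ∀ {ℓ} → Vector ℤ ℓ → Vector ℤ ℓ → ℤ
  ⟨ u , v ⟩ = ∑ (λ i → u i * v i)

  ⟨⟩-comm : ∀ {ℓ} (u v : Vector ℤ ℓ) → ⟨ u , v ⟩ ≡ ⟨ v , u ⟩
  ⟨⟩-comm u v = sum-cong-≗ (λ i → *-comm (u i) (v i))

  ⟨⟩-linearˡ : ∀ {ℓ} a b (x z y : Vector ℤ ℓ) →
               ⟨ (λ i → a * x i - b * z i) , y ⟩ ≡ a * ⟨ x , y ⟩ - b * ⟨ z , y ⟩
  ⟨⟩-linearˡ a b x z y = begin
    ⟨ (λ i → a * x i - b * z i) , y ⟩
      ≡⟨ sum-cong-≗ (λ i → distrib a b (x i) (z i) (y i)) ⟩
    ∑ (λ i → a * (x i * y i) + - b * (z i * y i))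
      ≡⟨ ∑-distrib-+ (λ i → a * (x i * y i)) (λ i → - b * (z i * y i)) ⟩
    ∑ (λ i → a * (x i * y i)) + ∑ (λ i → - b * (z i * y i))
      ≡⟨ sym (cong₂ _+_ (*-distribˡ-sum a (λ i → x i * y i))
                         (*-distribˡ-sum (- b) (λ i → z i * y i))) ⟩
    a * ⟨ x , y ⟩ + - b * ⟨ z , y ⟩
      ≡⟨ cong (λ t → a * ⟨ x , y ⟩ + t) (sym (neg-distribˡ-* b ⟨ z , y ⟩)) ⟩
    a * ⟨ x , y ⟩ - b * ⟨ z , y ⟩ ∎
    where
    open ≡-Reasoning
    distrib : ∀ a b x z y → (a * x - b * z) * y ≡ a * (x * y) + - b * (z * y)
    distrib = solve-∀

  ⟨⟩-linearʳ : ∀ {ℓ} c d (x y w : Vector ℤ ℓ) →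
               ⟨ x , (λ i → c * y i - d * w i) ⟩ ≡ c * ⟨ x , y ⟩ - d * ⟨ x , w ⟩
  ⟨⟩-linearʳ c d x y w = begin
    ⟨ x , (λ i → c * y i - d * w i) ⟩  ≡⟨ ⟨⟩-comm x _ ⟩
    ⟨ (λ i → c * y i - d * w i) , x ⟩  ≡⟨ ⟨⟩-linearˡ c d y w x ⟩
    c * ⟨ y , x ⟩ - d * ⟨ w , x ⟩
      ≡⟨ cong₂ (λ s t → c * s - d * t) (⟨⟩-comm y x) (⟨⟩-comm w x) ⟩
    c * ⟨ x , y ⟩ - d * ⟨ x , w ⟩      ∎
    where open ≡-Reasoning

  ⟨⟩-removeAt : ∀ {ℓ} (u v : Vector ℤ (suc ℓ)) r → v r ≡ 0ℤ →
                ⟨ removeAt u r , removeAt v r ⟩ ≡ ⟨ u , v ⟩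
  ⟨⟩-removeAt {ℓ} u v r vr≡0 = sym (begin
    ⟨ u , v ⟩                    ≡⟨ sum-remove {i = r} (λ i → u i * v i) ⟩
    u r * v r + ⟨ u′ , v′ ⟩      ≡⟨ cong (λ c → u r * c + ⟨ u′ , v′ ⟩) vr≡0 ⟩
    u r * 0ℤ + ⟨ u′ , v′ ⟩       ≡⟨ cong (λ c → c + ⟨ u′ , v′ ⟩) (*-zeroʳ (u r)) ⟩
    0ℤ + ⟨ u′ , v′ ⟩             ≡⟨ +-identityˡ ⟨ u′ , v′ ⟩ ⟩
    ⟨ u′ , v′ ⟩                  ∎)
    where
    open ≡-Reasoning
    u′ v′ : Vector ℤ ℓ
    u′ = removeAt u r
    v′ = removeAt v r

  ∣⟨⟩ : ∀ {ℓ d} (u v : Vector ℤ ℓ) → (∀ i → d ∣ v i) → d ∣ ⟨ u , v ⟩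
  ∣⟨⟩ {zero}  u v d∣v = divides 0ℤ refl
  ∣⟨⟩ {suc ℓ} u v d∣v = ∣m∣n⇒∣m+n (∣n⇒∣m*n (u zero) (d∣v zero)) (∣⟨⟩ (tail u) (tail v) (d∣v ∘ suc))

  toℤ : ∀ {q ℓ} → Vec (Fin q) ℓ → Vector ℤ ℓ
  toℤ v i = + toℕ (lookup v i)

  ⟨toℤ,toℤ⟩ : ∀ {q ℓ} (u v : Vec (Fin q) ℓ) → ⟨ toℤ u , toℤ v ⟩ ≡ + innerProd u v
  ⟨toℤ,toℤ⟩ []      []      = refl
  ⟨toℤ,toℤ⟩ (a ∷ u) (b ∷ v) = begin
    + toℕ a * + toℕ b + ⟨ toℤ u , toℤ v ⟩
      ≡⟨ cong₂ _+_ (sym (pos-* (toℕ a) (toℕ b))) (⟨toℤ,toℤ⟩ u v) ⟩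
    + (toℕ a ℕ.* toℕ b) + + innerProd u v
      ≡⟨ sym (pos-+ (toℕ a ℕ.* toℕ b) (innerProd u v)) ⟩
    + innerProd (a ∷ u) (b ∷ v) ∎
    where open ≡-Reasoning

  ∣⟨toℤ,toℤ⟩⇔∣innerProd : ∀ {p q ℓ} (u v : Vec (Fin q) ℓ) →
                          + p ∣ ⟨ toℤ u , toℤ v ⟩ ⇔ p ℕ.∣ innerProd u v
  ∣⟨toℤ,toℤ⟩⇔∣innerProd u v rewrite ⟨toℤ,toℤ⟩ u v = mk⇔ ∣⇒∣ᵤ ∣ᵤ⇒∣

  -- One step of Gaussian elimination with pivot ⟨ x₀ , y₀ ⟩ and pivot coordinate r: before
  -- removing coordinate r, reduceˡ x is orthogonal to y₀ and reduceʳ y vanishes at r.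
  module Pivot {ℓ} (x₀ y₀ : Vector ℤ (suc ℓ)) (r : Fin (suc ℓ)) where

    reduceˡ : Vector ℤ (suc ℓ) → Vector ℤ ℓ
    reduceˡ x = removeAt (λ i → ⟨ x₀ , y₀ ⟩ * x i - ⟨ x , y₀ ⟩ * x₀ i) r

    reduceʳ : Vector ℤ (suc ℓ) → Vector ℤ ℓ
    reduceʳ y = removeAt (λ i → y₀ r * y i - y r * y₀ i) r

    ⟨reduceˡ,reduceʳ⟩ : ∀ x y →
      ⟨ reduceˡ x , reduceʳ y ⟩ ≡ y₀ r * (⟨ x₀ , y₀ ⟩ * ⟨ x , y ⟩ - ⟨ x , y₀ ⟩ * ⟨ x₀ , y ⟩)
    ⟨reduceˡ,reduceʳ⟩ x y = begin
      ⟨ reduceˡ x , reduceʳ y ⟩            ≡⟨ ⟨⟩-removeAt x′ y′ r (commutator (y₀ r) (y r)) ⟩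
      ⟨ x′ , y′ ⟩                          ≡⟨ ⟨⟩-linearʳ c (y r) x′ y y₀ ⟩
      c * ⟨ x′ , y ⟩ - y r * ⟨ x′ , y₀ ⟩
        ≡⟨ cong₂ (λ s t → c * s - y r * t) (⟨⟩-linearˡ a b x x₀ y) (⟨⟩-linearˡ a b x x₀ y₀) ⟩
      c * (a * ⟨ x , y ⟩ - b * ⟨ x₀ , y ⟩) - y r * (a * b - b * a)
        ≡⟨ drop-vanishing c _ (y r) a b ⟩
      c * (a * ⟨ x , y ⟩ - b * ⟨ x₀ , y ⟩) ∎
      where
      open ≡-Reasoning
      a b c : ℤ
      a = ⟨ x₀ , y₀ ⟩
      b = ⟨ x , y₀ ⟩
      c = y₀ r
      x′ y′ : Vector ℤ (suc ℓ)
      x′ i = a * x i - b * x₀ i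
      y′ i = c * y i - y r * y₀ i
      commutator : ∀ u v → u * v - v * u ≡ 0ℤ
      commutator = solve-∀
      drop-vanishing : ∀ u w v s t → u * w - v * (s * t - t * s) ≡ u * w
      drop-vanishing = solve-∀

  module _ {p : ℕ} (p-prime : Prime p) where

    ∤*∤⇒∤* : ∀ {m n} → ¬ + p ∣ m → ¬ + p ∣ n → ¬ + p ∣ m * n
    ∤*∤⇒∤* {m} {n} p∤m p∤n p∣mn
      with euclidsLemma ∣ m ∣ℤ ∣ n ∣ℤ p-prime (subst (p ℕ.∣_) (abs-* m n) (∣⇒∣ᵤ p∣mn))
    ... | inj₁ p∣m = p∤m (∣ᵤ⇒∣ p∣m)
    ... | inj₂ p∣n = p∤n (∣ᵤ⇒∣ p∣n)

    pivotCoordinate : ∀ {ℓ} (x y : Vector ℤ ℓ) → ¬ + p ∣ ⟨ x , y ⟩ → ∃ λ r → ¬ + p ∣ y r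
    pivotCoordinate {ℓ} x y p∤xy = ¬∀⟶∃¬ ℓ (λ r → + p ∣ y r) (λ r → + p ∣? y r) (p∤xy ∘ ∣⟨⟩ x y)

    module PivotStep {ℓ} (x₀ y₀ : Vector ℤ (suc ℓ)) (r : Fin (suc ℓ))
                     (p∤x₀y₀ : ¬ + p ∣ ⟨ x₀ , y₀ ⟩) (p∤y₀r : ¬ + p ∣ y₀ r) where
      open Pivot x₀ y₀ r public

      reduce-∣ : ∀ x y → + p ∣ ⟨ x , y ⟩ → + p ∣ ⟨ x₀ , y ⟩ → + p ∣ ⟨ reduceˡ x , reduceʳ y ⟩
      reduce-∣ x y p∣xy p∣x₀y = subst (+ p ∣_) (sym (⟨reduceˡ,reduceʳ⟩ x y)) p∣rhs
        where
        p∣rhs : + p ∣ y₀ r * (⟨ x₀ , y₀ ⟩ * ⟨ x , y ⟩ - ⟨ x , y₀ ⟩ * ⟨ x₀ , y ⟩)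
        p∣rhs = ∣n⇒∣m*n (y₀ r) (∣m∣n⇒∣m-n (∣n⇒∣m*n ⟨ x₀ , y₀ ⟩ p∣xy) (∣n⇒∣m*n ⟨ x , y₀ ⟩ p∣x₀y))

      reduce-∤ : ∀ x y → ¬ + p ∣ ⟨ x , y ⟩ → + p ∣ ⟨ x₀ , y ⟩ → ¬ + p ∣ ⟨ reduceˡ x , reduceʳ y ⟩
      reduce-∤ x y p∤xy p∣x₀y p∣reduced =
        ∤*∤⇒∤* p∤y₀r p∤difference (subst (+ p ∣_) (⟨reduceˡ,reduceʳ⟩ x y) p∣reduced)
        where
        p∤difference : ¬ + p ∣ ⟨ x₀ , y₀ ⟩ * ⟨ x , y ⟩ - ⟨ x , y₀ ⟩ * ⟨ x₀ , y ⟩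
        p∤difference p∣difference =
          ∤*∤⇒∤* p∤x₀y₀ p∤xy (∣m+n∣n⇒∣m p∣difference (∣m⇒∣-m (∣n⇒∣m*n ⟨ x , y₀ ⟩ p∣x₀y)))

    triangular⇒length≤ : ∀ {ℓ} {I : Set} (x y : I → Vector ℤ ℓ) (is : List I) →
      All (λ i → ¬ + p ∣ ⟨ x i , y i ⟩) is → AllPairs (λ i j → + p ∣ ⟨ x i , y j ⟩) is →
      length is ≤ ℓ
    triangular⇒length≤ x y [] _ _ = z≤n
    triangular⇒length≤ {zero} x y (i ∷ _) (p∤xᵢyᵢ ∷ _) _ = ⊥-elim (p∤xᵢyᵢ (∣⟨⟩ (x i) (y i) λ ()))
    triangular⇒length≤ {suc ℓ} x y (i ∷ is) (p∤xᵢyᵢ ∷ diagonal) (p∣xᵢy ∷ offDiagonal)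
      with pivotCoordinate (x i) (y i) p∤xᵢyᵢ
    ... | r , p∤yᵢr = s≤s (triangular⇒length≤ (reduceˡ ∘ x) (reduceʳ ∘ y) is
            (All.zipWith (λ {j} (p∤xⱼyⱼ , p∣xᵢyⱼ) → reduce-∤ (x j) (y j) p∤xⱼyⱼ p∣xᵢyⱼ)
              (diagonal , p∣xᵢy))
            (AllPairs.map (λ {j} {k} (p∣xⱼyₖ , p∣xᵢyₖ) → reduce-∣ (x j) (y k) p∣xⱼyₖ p∣xᵢyₖ)
              (allPairs-zip-allʳ p∣xᵢy offDiagonal)))
      where open PivotStep (x i) (y i) r p∤xᵢyᵢ p∤yᵢr

    innerProd-triangular⇒length≤ : ∀ {q ℓ} {I : Set} (x y : I → Vec (Fin q) ℓ) (is : List I) →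
      All (λ i → ¬ p ℕ.∣ innerProd (x i) (y i)) is →
      AllPairs (λ i j → p ℕ.∣ innerProd (x i) (y j)) is →
      length is ≤ ℓ
    innerProd-triangular⇒length≤ x y is diagonal offDiagonal =
      triangular⇒length≤ (toℤ ∘ x) (toℤ ∘ y) is
        (All.map (λ {i} p∤xᵢyᵢ → p∤xᵢyᵢ ∘ Equivalence.to (∣⟨toℤ,toℤ⟩⇔∣innerProd (x i) (y i)))
          diagonal)
        (AllPairs.map (λ {i} {j} → Equivalence.from (∣⟨toℤ,toℤ⟩⇔∣innerProd (x i) (y j)))
          offDiagonal)

open InnerProduct

open import Data.Nat using (_+_; _*_; _^_; _∸_)
open import Data.Nat.Divisibility using (_∣_; _∣?_; divides; 1∣_; ∣-refl; ∣-trans; *-monoˡ-∣)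
open import Data.Nat.ListAction using (sum; product)
open import Data.Nat.ListAction.Properties using (∈⇒∣product)
open import Data.Nat.Primality.Factorisation using (factorisationHasAllPrimeFactors)
open import Data.Nat.Properties
  using (≤ᵇ⇒≤; ≤⇒≤ᵇ; +-cancelʳ-≤; +-monoˡ-≤; +-mono-≤; ≤-refl; ≤-trans; ≤-reflexive; n≤1+n; +-suc;
         +-comm; +-identityʳ; 1+n≰n; m≤n⇒∃[o]m+o≡n; m+n∸n≡m; module ≤-Reasoning)

subsets : ∀ m → List (Subset m)
subsets zero    = [ [] ]
subsets (suc m) = map (inside ∷_) (subsets m) ++ map (outside ∷_) (subsets m)

length-subsets : ∀ m → length (subsets m) ≡ 2 ^ m
length-subsets zero    = refl
length-subsets (suc m) = begin
  length (map (inside ∷_) (subsets m) ++ map (outside ∷_) (subsets m))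
    ≡⟨ length-++ (map (inside ∷_) (subsets m)) ⟩
  length (map (inside ∷_) (subsets m)) + length (map (outside ∷_) (subsets m))
    ≡⟨ cong₂ _+_ (length-map (inside ∷_) (subsets m)) (length-map (outside ∷_) (subsets m)) ⟩
  length (subsets m) + length (subsets m)
    ≡⟨ cong (λ k → k + k) (length-subsets m) ⟩
  2 ^ m + 2 ^ m
    ≡⟨ cong (2 ^ m +_) (sym (+-identityʳ (2 ^ m))) ⟩
  2 ^ suc m ∎
  where open ≡-Reasoning

subsets-⊈-later : ∀ m → AllPairs (λ A B → 1 ≤ ∣ A ∩ ∁ B ∣) (subsets m)
subsets-⊈-later zero    = [] ∷ []
subsets-⊈-later (suc m) = AllPairs.++⁺
  (AllPairs.map⁺ (subsets-⊈-later m))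
  (AllPairs.map⁺ (subsets-⊈-later m))
  (All.map⁺ (All.universal (λ _ → All.map⁺ (All.universal (λ _ → s≤s z≤n) (subsets m)))
                           (subsets m)))

pad : ∀ {m} s → Subset m → Subset (m + s)
pad s A = A ++ᵛ ⊤

∣pad∩pad∣ : ∀ {m} s (A B : Subset m) → ∣ pad s A ∩ pad s B ∣ ≡ ∣ A ∩ B ∣ + s
∣pad∩pad∣ s []            []            = trans (cong ∣_∣ (∩-idem (⊤ {n = s}))) (∣⊤∣≡n s)
∣pad∩pad∣ s (inside ∷ A)  (inside ∷ B)  = cong suc (∣pad∩pad∣ s A B)
∣pad∩pad∣ s (inside ∷ A)  (outside ∷ B) = ∣pad∩pad∣ s A B
∣pad∩pad∣ s (outside ∷ A) (_ ∷ B)       = ∣pad∩pad∣ s A B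

THR-pad : ∀ {m} s (A B : Subset m) → THR (m + s) (suc s) (pad s A) (pad s B) ≡ true ⇔ 1 ≤ ∣ A ∩ B ∣
THR-pad s A B = mk⇔
  (λ thr → +-cancelʳ-≤ s 1 ∣ A ∩ B ∣
    (subst (suc s ≤_) (∣pad∩pad∣ s A B) (≤ᵇ⇒≤ (suc s) _ (Equivalence.from T-≡ thr))))
  (λ 1≤∣A∩B∣ → Equivalence.to T-≡
    (≤⇒≤ᵇ (subst (suc s ≤_) (sym (∣pad∩pad∣ s A B)) (+-monoˡ-≤ s 1≤∣A∩B∣))))

distinctPrimes⇒product∣ : ∀ {ps n} → All Prime ps → Unique ps → All (_∣ n) ps → product ps ∣ n
distinctPrimes⇒product∣ {n = n} [] [] [] = 1∣ n
distinctPrimes⇒product∣ {p ∷ ps} (p-prime ∷ ps-prime) (p∉ps ∷ ps-unique) (p∣n ∷ ps∣n)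
  with distinctPrimes⇒product∣ ps-prime ps-unique ps∣n
... | divides k n≡k*∏ps with euclidsLemma k (product ps) p-prime (subst (p ∣_) n≡k*∏ps p∣n)
...   | inj₁ p∣k   = subst (p * product ps ∣_) (sym n≡k*∏ps) (*-monoˡ-∣ (product ps) p∣k)
...   | inj₂ p∣∏ps =
  ⊥-elim (All¬⇒¬Any p∉ps (factorisationHasAllPrimeFactors p-prime p∣∏ps ps-prime))

module _ {A B : Set} {Q : B → A → Set} (Q? : ∀ b → Decidable (Q b)) where

  classSize : B → List A → ℕ
  classSize b as = length (filter (Q? b) as)

  classTotal : List B → List A → ℕ
  classTotal bs as = sum (map (λ b → classSize b as) bs)

  classTotal-∷-≤ : ∀ bs a as → classTotal bs as ≤ classTotal bs (a ∷ as)
  classTotal-∷-≤ []       a as = z≤n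
  classTotal-∷-≤ (b ∷ bs) a as with Q? b a
  ... | yes _ = +-mono-≤ (n≤1+n (classSize b as)) (classTotal-∷-≤ bs a as)
  ... | no  _ = +-mono-≤ (≤-refl {classSize b as}) (classTotal-∷-≤ bs a as)

  classTotal-∷-< : ∀ bs a as → Any (λ b → Q b a) bs →
                   suc (classTotal bs as) ≤ classTotal bs (a ∷ as)
  classTotal-∷-< (b ∷ bs) a as (here qba) with Q? b a
  ... | yes _   = s≤s (+-mono-≤ (≤-refl {classSize b as}) (classTotal-∷-≤ bs a as))
  ... | no ¬qba = ⊥-elim (¬qba qba)
  classTotal-∷-< (b ∷ bs) a as (there qa) with Q? b a
  ... | yes _ = s≤s (+-mono-≤ (≤-refl {classSize b as})
                  (≤-trans (n≤1+n (classTotal bs as)) (classTotal-∷-< bs a as qa)))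
  ... | no  _ = ≤-trans (≤-reflexive (sym (+-suc (classSize b as) (classTotal bs as))))
                  (+-mono-≤ (≤-refl {classSize b as}) (classTotal-∷-< bs a as qa))

  length≤classTotal : ∀ bs as → All (λ a → Any (λ b → Q b a) bs) as → length as ≤ classTotal bs as
  length≤classTotal bs []       []         = z≤n
  length≤classTotal bs (a ∷ as) (qa ∷ qas) =
    ≤-trans (s≤s (length≤classTotal bs as qas)) (classTotal-∷-< bs a as qa)

sum-map-≤ : ∀ {B : Set} (h : B → ℕ) {ℓ} (bs : List B) → All (λ b → h b ≤ ℓ) bs →
            sum (map h bs) ≤ length bs * ℓ
sum-map-≤ h []       []           = z≤n
sum-map-≤ h (b ∷ bs) (hb≤ℓ ∷ hbs≤ℓ) = +-mono-≤ hb≤ℓ (sum-map-≤ h bs hbs≤ℓ)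

module _ {m s q ℓ : ℕ} (f g : Subset (m + s) → Vec (Fin q) ℓ)
         (encoding : IsIPEncoding (THR (m + s) (suc s)) q ℓ f g) where

  entry : Subset m → Subset m → ℕ
  entry A B = innerProd (f (pad s A)) (g (pad s (∁ B)))

  q∤entry-diagonal : ∀ A → ¬ q ∣ entry A A
  q∤entry-diagonal A q∣entry = 1+n≰n (subst (1 ≤_) ∣A∩∁A∣≡0
    (Equivalence.to (THR-pad s A (∁ A))
      (Equivalence.from (encoding (pad s A) (pad s (∁ A))) q∣entry)))
    where
    ∣A∩∁A∣≡0 : ∣ A ∩ ∁ A ∣ ≡ 0
    ∣A∩∁A∣≡0 = trans (cong ∣_∣ (∩-inverseʳ A)) (∣⊥∣≡0 m)

  q∣entry-⊈ : ∀ {A B} → 1 ≤ ∣ A ∩ ∁ B ∣ → q ∣ entry A B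
  q∣entry-⊈ {A} {B} A⊈B =
    Equivalence.to (encoding (pad s A) (pad s (∁ B))) (Equivalence.from (THR-pad s A (∁ B)) A⊈B)

  ⊈-ordered⇒length≤ : ∀ {p} → Prime p → p ∣ q → (As : List (Subset m)) →
    AllPairs (λ A B → 1 ≤ ∣ A ∩ ∁ B ∣) As → All (λ A → ¬ p ∣ entry A A) As → length As ≤ ℓ
  ⊈-ordered⇒length≤ {p} p-prime p∣q As ordered p∤diagonal =
    innerProd-triangular⇒length≤ p-prime (f ∘ pad s) (g ∘ pad s ∘ ∁) As p∤diagonal
      (AllPairs.map (∣-trans p∣q ∘ q∣entry-⊈) ordered)

  prime⇒2^m≤length : Prime q → 2 ^ m ≤ ℓ
  prime⇒2^m≤length q-prime = subst (_≤ ℓ) (length-subsets m)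
    (⊈-ordered⇒length≤ q-prime ∣-refl (subsets m) (subsets-⊈-later m)
      (All.universal q∤entry-diagonal (subsets m)))

  distinctPrimes⇒2^m≤k*length : ∀ {k} → ProductOfDistinctPrimes q k → 2 ^ m ≤ k * ℓ
  distinctPrimes⇒2^m≤k*length (ps , refl , ps-prime , ps-unique , refl) = begin
    2 ^ m                         ≡⟨ sym (length-subsets m) ⟩
    length (subsets m)            ≤⟨ length≤classTotal Q? ps (subsets m) covered ⟩
    classTotal Q? ps (subsets m)  ≤⟨ sum-map-≤ (λ p → classSize Q? p (subsets m)) ps bound ⟩
    length ps * ℓ                 ∎
    where
    open ≤-Reasoning
    Q : ℕ → Subset m → Set
    Q p A = ¬ p ∣ entry A A
    Q? : ∀ p → Decidable (Q p)
    Q? p A = ¬? (p ∣? entry A A)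
    covered : All (λ A → Any (λ p → Q p A) ps) (subsets m)
    covered = All.universal
      (λ A → ¬All⇒Any¬ (_∣? entry A A) ps
               (q∤entry-diagonal A ∘ distinctPrimes⇒product∣ ps-prime ps-unique))
      (subsets m)
    bound : All (λ p → classSize Q? p (subsets m) ≤ ℓ) ps
    bound = All.tabulate λ {p} p∈ps →
      ⊈-ordered⇒length≤ (All.lookup ps-prime p∈ps) (∈⇒∣product p∈ps) (filter (Q? p) (subsets m))
        (AllPairs.filter⁺ (Q? p) (subsets-⊈-later m)) (all-filter (Q? p) (subsets m))

m<n⇒∃[o]n≡1+o+m : ∀ {m n} → m < n → ∃ λ o → n ≡ suc o + m
m<n⇒∃[o]n≡1+o+m {m} m<n with m≤n⇒∃[o]m+o≡n m<n
... | o , refl = o , cong suc (+-comm m o)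

mainTheorem10 : (n t q k : ℕ) → 1 ≤ t → t ≤ n → 1 ≤ k → ProductOfDistinctPrimes q k
    → ((ℓ : ℕ) (f g : Subset n → Vec (Fin q) ℓ) → IsIPEncoding (THR n t) q ℓ f g
    → 2 ^ suc (n ∸ t) ≤ k * ℓ)
    × (Prime q → (ℓ : ℕ) (f g : Subset n → Vec (Fin q) ℓ) → IsIPEncoding (THR n t) q ℓ f g
    → 2 ^ suc (n ∸ t) ≤ ℓ)
mainTheorem10 n zero    q k () _ _ _
mainTheorem10 n (suc s) q k _ t≤n _ q-squarefree with m<n⇒∃[o]n≡1+o+m t≤n
... | o , refl rewrite m+n∸n≡m o s =
  (λ ℓ f g encoding → distinctPrimes⇒2^m≤k*length {m = suc o} {s = s} f g encoding q-squarefree) ,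
  (λ q-prime ℓ f g encoding → prime⇒2^m≤length {m = suc o} {s = s} f g encoding q-prime)
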